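{- Let $L_3$ be the graph with vertex set $\{a,b\}\cup\{c_i,x_i,y_i:1\le i\le 5\}$ and edge set consisting of $(a,b)$ and, for each $1\le i\le 5$, the edges $(a,c_i),(b,c_i),(a,x_i),(c_i,x_i),(b,y_i),(c_i,y_i)$. Let $\theta=(\Pi_1,\Pi_2)$ be any rectangle representation of $L_3$. Then $a,b$ is not a crossing pair with respect to $\theta$.
   Context: A rectangle representation of a graph $G$ is a map $\theta$ assigning to each vertex $v$ an axis-parallel rectangle $\theta(v)=\Pi_1(v)\times\Pi_2(v)\subseteq\mathbb{R}^2$, where $\Pi_1(v),\Pi_2(v)$ are closed intervals of the real line, such that for distinct vertices $u,v$, $(u,v)$ is an edge of $G$ iff $\theta(u)\cap\theta(v)\neq\emptyset$; we write $\theta=(\Pi_1,\Pi_2)$. Two vertices $u,v$ form a crossing pair with respect to $\theta$ if either ($\Pi_1(u)\subseteq\Pi_1(v)$ and $\Pi_2(v)\subseteq\Pi_2(u)$) or ($\Pi_1(v)\subseteq\Pi_1(u)$ and $\Pi_2(u)\subseteq\Pi_2(v)$). -}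

module Defs where

open import Level using (Level; _⊔_)
open import Data.Fin using (Fin)
open import Data.Product using (_×_; ∃; _,_)
open import Data.Sum using (_⊎_)
open import Relation.Binary.Bundles using (TotalOrder)
open import Relation.Binary.PropositionalEquality using (_≡_)
open import Relation.Nullary using (¬_)
open import Function.Bundles using (_⇔_)

data V : Set where
  a b : V
  c x y : Fin 5 → V

data Edge : V → V → Set where
  e-ab : Edge a b
  e-ac : ∀ i → Edge a (c i)
  e-bc : ∀ i → Edge b (c i)
  e-ax : ∀ i → Edge a (x i)
  e-cx : ∀ i → Edge (c i) (x i)
  e-by : ∀ i → Edge b (y i)
  e-cy : ∀ i → Edge (c i) (y i)

Adj : V → V → Set
Adj u v = Edge u v ⊎ Edge v u

-- Geometry over an arbitrary totally ordered carrier (ℝ being one instance).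
module Geometry {c ℓ₁ ℓ₂ : Level} (O : TotalOrder c ℓ₁ ℓ₂) where
  open TotalOrder O renaming (Carrier to R)

  record Interval : Set (c ⊔ ℓ₂) where
    constructor [_,_]⟨_⟩
    field
      lo hi : R
      lo≤hi : lo ≤ hi
  open Interval public

  _∈I_ : R → Interval → Set ℓ₂
  t ∈I I = (lo I ≤ t) × (t ≤ hi I)

  _⊆I_ : Interval → Interval → Set (c ⊔ ℓ₂)
  I ⊆I J = ∀ t → t ∈I I → t ∈I J

  Rect : Set (c ⊔ ℓ₂)
  Rect = Interval × Interval

  _∈R_ : R × R → Rect → Set ℓ₂
  (p₁ , p₂) ∈R (I₁ , I₂) = (p₁ ∈I I₁) × (p₂ ∈I I₂)

  Meet : Rect → Rect → Set (c ⊔ ℓ₂)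
  Meet P Q = ∃ λ p → (p ∈R P) × (p ∈R Q)

  IsRectRep : (V → Interval) → (V → Interval) → Set (c ⊔ ℓ₂)
  IsRectRep Π₁ Π₂ =
    ∀ u v → ¬ (u ≡ v) → Adj u v ⇔ Meet (Π₁ u , Π₂ u) (Π₁ v , Π₂ v)

  CrossingPair : (V → Interval) → (V → Interval) → V → V → Set (c ⊔ ℓ₂)
  CrossingPair Π₁ Π₂ u v =
    ((Π₁ u ⊆I Π₁ v) × (Π₂ v ⊆I Π₂ u)) ⊎ ((Π₁ v ⊆I Π₁ u) × (Π₂ u ⊆I Π₂ v))

-- Up to the symmetry a ↔ b, x ↔ y, say θ(a) = A₁ × A₂ and θ(b) = B₁ × B₂ with
-- A₁ ⊆ B₁ and B₂ ⊆ A₂, so that the two rectangles form a cross whose centre is A₁ × B₂.  Each cᵢ meets both arms.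
-- If Π₁(cᵢ) ⊆ A₁, then yᵢ, which meets b and cᵢ, would also meet a; so Π₁(cᵢ)
-- contains an endpoint of A₁.  Symmetrically (using xᵢ) Π₂(cᵢ) contains an
-- endpoint of B₂, hence θ(cᵢ) contains one of the four corners of A₁ × B₂.
-- By pigeonhole two of the five θ(cᵢ) share a corner, yet they are pairwise disjoint.
module Submission where

open import Defs
open import Level using (Level)
open import Data.Fin using (Fin; zero; suc; combine)
open import Data.Fin.Properties using (pigeonhole; combine-injective; <⇒≢)
open import Data.Nat using (_<_)
open import Data.Nat.Properties using (n<1+n)
open import Data.Product using (_×_; ∃; ∃₂; _,_; proj₁; proj₂)
open import Data.Sum using (_⊎_; inj₁; inj₂)
open import Data.Empty using (⊥-elim)
open import Relation.Binary.Bundles using (TotalOrder)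
open import Relation.Binary.PropositionalEquality using (_≢_; refl)
open import Relation.Nullary using (¬_)
open import Function.Bundles using (Equivalence)

module Rectangles {o ℓ₁ ℓ₂ : Level} (O : TotalOrder o ℓ₁ ℓ₂) where
  open Geometry O
  open TotalOrder O using (trans; total) renaming (Carrier to R)

  endpoint : Interval → Fin 2 → R
  endpoint I zero       = lo I
  endpoint I (suc zero) = hi I

  overlap⇒endpoint∈⊎⊆ : ∀ C J {t} → t ∈I C → t ∈I J →
                        (∃ λ e → endpoint J e ∈I C) ⊎ C ⊆I J
  overlap⇒endpoint∈⊎⊆ C J (C≤t , t≤C) (J≤t , t≤J) with total (hi J) (hi C)
  ... | inj₁ hiJ≤hiC = inj₁ (suc zero , trans C≤t t≤J , hiJ≤hiC)
  ... | inj₂ hiC≤hiJ with total (lo C) (lo J)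
  ...   | inj₁ loC≤loJ = inj₁ (zero , loC≤loJ , trans J≤t t≤C)
  ...   | inj₂ loJ≤loC = inj₂ λ s (C≤s , s≤C) → trans loJ≤loC C≤s , trans s≤C hiC≤hiJ

  corner : Interval → Interval → Fin 2 → Fin 2 → R × R
  corner I J e f = endpoint I e , endpoint J f

  -- Rectangles are explicit arguments: the lo≤hi field of an Interval is not
  -- determined by ∈I, ⊆I or Meet, so it could never be inferred.
  meet-fromProjections : ∀ X P Q U →
                         Meet X P → Meet X Q → proj₁ P ⊆I proj₁ U → proj₂ Q ⊆I proj₂ U →
                         Meet X U
  meet-fromProjections _ _ _ _ ((p₁ , _) , (p₁∈X₁ , _) , (p₁∈P₁ , _))
                       ((_ , q₂) , (_ , q₂∈X₂) , (_ , q₂∈Q₂)) P₁⊆U₁ Q₂⊆U₂ =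
    (p₁ , q₂) , (p₁∈X₁ , q₂∈X₂) , (P₁⊆U₁ p₁ p₁∈P₁ , Q₂⊆U₂ q₂ q₂∈Q₂)

  cross⇒corner∈ : ∀ U W C X Y →
                  proj₁ U ⊆I proj₁ W → proj₂ W ⊆I proj₂ U →
                  Meet C U → Meet C W →
                  Meet X U → Meet X C → ¬ Meet X W →
                  Meet Y W → Meet Y C → ¬ Meet Y U →
                  ∃₂ λ e f → corner (proj₁ U) (proj₂ W) e f ∈R C
  cross⇒corner∈ U@(U₁ , _) W@(_ , W₂) C@(C₁ , C₂) X Y U₁⊆W₁ W₂⊆U₂
                (_ , (p∈C₁ , _) , (p∈U₁ , _)) (_ , (_ , q∈C₂) , (_ , q∈W₂))
                X∩U X∩C X∌W Y∩W Y∩C Y∌U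
    with overlap⇒endpoint∈⊎⊆ C₁ U₁ p∈C₁ p∈U₁ | overlap⇒endpoint∈⊎⊆ C₂ W₂ q∈C₂ q∈W₂
  ... | inj₂ C₁⊆U₁ | _ = ⊥-elim (Y∌U (meet-fromProjections Y C W U Y∩C Y∩W C₁⊆U₁ W₂⊆U₂))
  ... | _ | inj₂ C₂⊆W₂ = ⊥-elim (X∌W (meet-fromProjections X U C W X∩U X∩C U₁⊆W₁ C₂⊆W₂))
  ... | inj₁ (e , e∈C₁) | inj₁ (f , f∈C₂) = e , f , e∈C₁ , f∈C₂

  corner∈-pigeonhole : ∀ {n} I J (C : Fin n → Rect) → 4 < n →
                       (∀ i → ∃₂ λ e f → corner I J e f ∈R C i) →
                       ∃₂ λ i j → i ≢ j × Meet (C i) (C j)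
  corner∈-pigeonhole I J C 4<n corner∈C
    with pigeonhole 4<n (λ i → let (e , f , _) = corner∈C i in combine e f)
  ... | i , j , i<j , same
    with corner∈C i | corner∈C j
  ...   | e , f , p∈Cᵢ | e′ , f′ , p∈Cⱼ
    with combine-injective e f e′ f′ same
  ...     | refl , refl = i , j , <⇒≢ i<j , corner I J e f , p∈Cᵢ , p∈Cⱼ

Adj-irrefl : ∀ {u} → ¬ Adj u u
Adj-irrefl (inj₁ ())
Adj-irrefl (inj₂ ())

module Representation {o ℓ₁ ℓ₂ : Level} (O : TotalOrder o ℓ₁ ℓ₂)
                      (Π₁ Π₂ : V → Geometry.Interval O) (rep : Geometry.IsRectRep O Π₁ Π₂) where
  open Geometry O
  open Rectangles O

  θ : V → Rect
  θ v = Π₁ v , Π₂ v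

  adjacent⇒meet : ∀ {u v} → Adj u v → Meet (θ u) (θ v)
  adjacent⇒meet {u} {v} uv = Equivalence.to (rep u v λ { refl → Adj-irrefl uv }) uv

  nonadjacent⇒disjoint : ∀ {u v} → u ≢ v → ¬ Adj u v → ¬ Meet (θ u) (θ v)
  nonadjacent⇒disjoint {u} {v} u≢v ¬uv m = ¬uv (Equivalence.from (rep u v u≢v) m)

  c-disjoint : ∀ {i j} → i ≢ j → ¬ Meet (θ (c i)) (θ (c j))
  c-disjoint i≢j = nonadjacent⇒disjoint (λ { refl → i≢j refl }) λ { (inj₁ ()) ; (inj₂ ()) }

  c∩a : ∀ i → Meet (θ (c i)) (θ a)
  c∩a i = adjacent⇒meet (inj₂ (e-ac i))

  c∩b : ∀ i → Meet (θ (c i)) (θ b)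
  c∩b i = adjacent⇒meet (inj₂ (e-bc i))

  x∩a : ∀ i → Meet (θ (x i)) (θ a)
  x∩a i = adjacent⇒meet (inj₂ (e-ax i))

  x∩c : ∀ i → Meet (θ (x i)) (θ (c i))
  x∩c i = adjacent⇒meet (inj₂ (e-cx i))

  x∌b : ∀ i → ¬ Meet (θ (x i)) (θ b)
  x∌b i = nonadjacent⇒disjoint (λ ()) λ { (inj₁ ()) ; (inj₂ ()) }

  y∩b : ∀ i → Meet (θ (y i)) (θ b)
  y∩b i = adjacent⇒meet (inj₂ (e-by i))

  y∩c : ∀ i → Meet (θ (y i)) (θ (c i))
  y∩c i = adjacent⇒meet (inj₂ (e-cy i))

  y∌a : ∀ i → ¬ Meet (θ (y i)) (θ a)
  y∌a i = nonadjacent⇒disjoint (λ ()) λ { (inj₁ ()) ; (inj₂ ()) }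

  no-corner∈c : ∀ I J → ¬ (∀ i → ∃₂ λ e f → corner I J e f ∈R θ (c i))
  no-corner∈c I J corner∈c with corner∈-pigeonhole I J (λ i → θ (c i)) (n<1+n 4) corner∈c
  ... | _ , _ , i≢j , m = c-disjoint i≢j m

lemma6 : ∀ {c ℓ₁ ℓ₂} (O : TotalOrder c ℓ₁ ℓ₂) →
           let open Geometry O in
           (Π₁ Π₂ : V → Interval) → IsRectRep Π₁ Π₂ → ¬ CrossingPair Π₁ Π₂ a b
lemma6 O Π₁ Π₂ rep = λ
  { (inj₁ (a₁⊆b₁ , b₂⊆a₂)) → no-corner∈c (Π₁ a) (Π₂ b) λ i →
      cross⇒corner∈ (θ a) (θ b) (θ (c i)) (θ (x i)) (θ (y i)) a₁⊆b₁ b₂⊆a₂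
        (c∩a i) (c∩b i) (x∩a i) (x∩c i) (x∌b i) (y∩b i) (y∩c i) (y∌a i)
  ; (inj₂ (b₁⊆a₁ , a₂⊆b₂)) → no-corner∈c (Π₁ b) (Π₂ a) λ i →
      cross⇒corner∈ (θ b) (θ a) (θ (c i)) (θ (y i)) (θ (x i)) b₁⊆a₁ a₂⊆b₂
        (c∩b i) (c∩a i) (y∩b i) (y∩c i) (y∌a i) (x∩a i) (x∩c i) (x∌b i)
  }
  where open Rectangles O
        open Representation O Π₁ Π₂ rep
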